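{- Let $G$ be a simple graph with $n$ vertices, maximum degree $\Delta$, minimum degree $\delta$, and let $N_\Delta$, $N_\delta$ be the numbers of vertices of degree $\Delta$ and $\delta$. Then $$\mathrm{Var}(G)\ge \frac{(N_\delta+N_\Delta)^2}{n^4}\,IRR(G)\,IRD(G),$$ with equality if and only if $G$ has at most two distinct vertex degrees.
   Context: With $m$ the number of edges and $d_1,\dots,d_n$ the degrees, $\mathrm{Var}(G)=\frac1n\sum_{i=1}^n\left(d_i-\frac{2m}{n}\right)^2$, $IRR(G)=\frac n2(\Delta-\delta)$, and $IRD(G)=\frac{2N_\Delta N_\delta}{N_\delta+N_\Delta}(\Delta-\delta)$. -}

module Defs where

open import Data.Bool using (Bool; true; false; if_then_else_; _∧_)
open import Data.Nat as ℕ using (ℕ; zero; suc; _⊔_; _⊓_; _≡ᵇ_; _<ᵇ_)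
open import Data.Fin using (Fin; toℕ)
open import Data.List using (List; []; _∷_; map; foldr; allFin)
open import Data.Nat.ListAction using (sum)
open import Data.Integer using (ℤ; +_)
open import Data.Rational using (ℚ; 0ℚ; _/_; _+_; _*_; _-_)
open import Relation.Binary.PropositionalEquality using (_≡_)
open import Data.Sum using () renaming (_⊎_ to _⊎'_)

record SimpleGraph (n : ℕ) : Set where
  field
    adj    : Fin n → Fin n → Bool
    sym    : ∀ i j → adj i j ≡ adj j i
    irrefl : ∀ i → adj i i ≡ false
open SimpleGraph public

Σv : {n : ℕ} → (Fin n → ℕ) → ℕ
Σv {n} f = sum (map f (allFin n))

Σq : {n : ℕ} → (Fin n → ℚ) → ℚ
Σq {n} f = foldr _+_ 0ℚ (map f (allFin n))

b2n : Bool → ℕ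
b2n true  = 1
b2n false = 0

deg : {n : ℕ} → SimpleGraph n → Fin n → ℕ
deg G i = Σv (λ j → b2n (adj G i j))

edges : {n : ℕ} → SimpleGraph n → ℕ
edges G = Σv (λ i → Σv (λ j → b2n (adj G i j ∧ (toℕ i <ᵇ toℕ j))))

maxL : List ℕ → ℕ
maxL = foldr _⊔_ 0

minL : List ℕ → ℕ
minL []       = 0
minL (x ∷ xs) = foldr _⊓_ x xs

degrees : {n : ℕ} → SimpleGraph n → List ℕ
degrees {n} G = map (deg G) (allFin n)

Δ : {n : ℕ} → SimpleGraph n → ℕ
Δ G = maxL (degrees G)

δ : {n : ℕ} → SimpleGraph n → ℕ
δ G = minL (degrees G)

Ndeg : {n : ℕ} → SimpleGraph n → ℕ → ℕ
Ndeg G k = Σv (λ i → b2n (deg G i ≡ᵇ k))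

NΔ : {n : ℕ} → SimpleGraph n → ℕ
NΔ G = Ndeg G (Δ G)

Nδ : {n : ℕ} → SimpleGraph n → ℕ
Nδ G = Ndeg G (δ G)

ℕ→ℚ : ℕ → ℚ
ℕ→ℚ k = + k / 1

-- a / d with the convention a / 0 = 0 (only used with nonzero denominators
-- under the theorem's hypothesis n ≥ 1)
infixl 7 _/'_
_/'_ : ℤ → ℕ → ℚ
a /' zero  = 0ℚ
a /' suc d = a / suc d

sq : ℚ → ℚ
sq x = x * x

Var : {n : ℕ} → SimpleGraph n → ℚ
Var {n} G = (+ 1 /' n) * Σq (λ i → sq (ℕ→ℚ (deg G i) - (+ (2 ℕ.* edges G) /' n)))

IRR : {n : ℕ} → SimpleGraph n → ℚ
IRR {n} G = (+ n /' 2) * (ℕ→ℚ (Δ G) - ℕ→ℚ (δ G))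

IRD : {n : ℕ} → SimpleGraph n → ℚ
IRD G = (+ (2 ℕ.* NΔ G ℕ.* Nδ G) /' (Nδ G ℕ.+ NΔ G)) * (ℕ→ℚ (Δ G) - ℕ→ℚ (δ G))

AtMostTwoDegrees : {n : ℕ} → SimpleGraph n → Set
AtMostTwoDegrees G = ∀ i j k → deg G i ≡ deg G j ⊎' (deg G j ≡ deg G k ⊎' deg G i ≡ deg G k)

-- Write α = NΔ, β = Nδ, c = 2m/n for the mean degree and S = Σᵢ (dᵢ - c)², so that
-- Var(G) = S/n while the right-hand side equals (β + α) α β (Δ - δ)² / n³; the claim is
-- therefore (β + α) α β (Δ - δ)² ≤ n² S.  With X = Δ - c, Y = δ - c and T = β Y² + α X²,
-- the part of S contributed by the vertices of degree Δ or δ, one has the identity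
--   (β + α) T = α β (Δ - δ)² + (α X + β Y)²,
-- hence (β + α) α β (Δ - δ)² ≤ n α β (Δ - δ)² ≤ n (β + α) T ≤ n² S, using β + α ≤ n and
-- T ≤ S.  If every degree is Δ or δ, then β + α = n, T = S and α X + β Y = 2m - n c = 0, so
-- every step is an equality.  Otherwise β + α < n, and α β (Δ - δ)² > 0 makes the first
-- step strict.

module Submission where

open import Algebra.Bundles using (CommutativeMonoid)
open import Data.Bool using (true; false; T; _∧_)
open import Data.Fin using (Fin; toℕ)
import Data.Fin.Properties as Fin
open import Data.Integer using (+_)
import Data.Integer as ℤ
import Data.Integer.Properties as ℤ
open import Data.List using (List; []; _∷_; map; foldr; length; allFin)
import Data.List.Properties as List
open import Data.List.Membership.Propositional using (_∈_)
open import Data.List.Membership.Propositional.Properties using (foldr-selective; ∈-map⁺; ∈-map⁻; ∈-allFin)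
open import Data.List.Relation.Unary.All as All using (All; []; _∷_)
open import Data.List.Relation.Unary.All.Properties using (map⁺; ¬All⇒Any¬)
open import Data.List.Relation.Unary.Any as Any using (Any; here; there)
open import Data.Nat using (ℕ; zero; suc; _≤_; _^_; _≡ᵇ_; _<ᵇ_) renaming (_+_ to _+ℕ_)
import Data.Nat as ℕ
import Data.Nat.Properties as ℕ
open import Data.Nat.ListAction using (sum)
open import Data.Product using (_×_; _,_)
open import Data.Rational using (ℚ; 0ℚ; 1ℚ; _+_; _*_; _-_; _<_; fromℚᵘ; nonNegative; nonPositive; positive; negative)
  renaming (_≤_ to _≤ℚ_)
open import Data.Rational.Properties
open import Data.Rational.Solver using (module +-*-Solver)
open import Data.Rational.Unnormalised using (mkℚᵘ; *≡*) renaming (_+_ to _+ᵘ_; _*_ to _*ᵘ_)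
import Data.Rational.Unnormalised.Properties as ℚᵘ
open import Data.Sum using (_⊎_; inj₁; inj₂; [_,_]′)
open import Data.Unit using (tt)
open import Function using (_∘_; id)
open import Function.Bundles using (_⇔_; mk⇔)
open import Relation.Binary using (tri<; tri≈; tri>)
open import Relation.Binary.PropositionalEquality
open import Relation.Nullary using (¬_; contradiction; Dec; yes; no; _⊎-dec_)

open import Defs hiding (sym)
open import Algebra.Properties.CommutativeSemigroup
  (CommutativeMonoid.commutativeSemigroup +-0-commutativeMonoid) using (interchange)
open import Algebra.Properties.Group +-0-group using (x∙y⁻¹≈ε⇒x≈y)
open +-*-Solver using (solve; _:=_; _:+_; _:*_; _:-_; con)

-- By definition ℕ→ℚ k and + j /' suc k are fromℚᵘ of the unnormalised fractions k/1 and j/(k+1).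

fromℚᵘ-+ : ∀ p q → fromℚᵘ (p +ᵘ q) ≡ fromℚᵘ p + fromℚᵘ q
fromℚᵘ-+ p q = toℚᵘ-injective (ℚᵘ.≃-trans (toℚᵘ-fromℚᵘ (p +ᵘ q)) (ℚᵘ.≃-sym
  (ℚᵘ.≃-trans (toℚᵘ-homo-+ (fromℚᵘ p) (fromℚᵘ q)) (ℚᵘ.+-cong (toℚᵘ-fromℚᵘ p) (toℚᵘ-fromℚᵘ q)))))

fromℚᵘ-* : ∀ p q → fromℚᵘ (p *ᵘ q) ≡ fromℚᵘ p * fromℚᵘ q
fromℚᵘ-* p q = toℚᵘ-injective (ℚᵘ.≃-trans (toℚᵘ-fromℚᵘ (p *ᵘ q)) (ℚᵘ.≃-sym
  (ℚᵘ.≃-trans (toℚᵘ-homo-* (fromℚᵘ p) (fromℚᵘ q)) (ℚᵘ.*-cong (toℚᵘ-fromℚᵘ p) (toℚᵘ-fromℚᵘ q)))))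

ℕ→ℚ-+ : ∀ m n → ℕ→ℚ (m +ℕ n) ≡ ℕ→ℚ m + ℕ→ℚ n
ℕ→ℚ-+ m n = trans
  (fromℚᵘ-cong {mkℚᵘ (+ (m +ℕ n)) 0} {mkℚᵘ (+ m) 0 +ᵘ mkℚᵘ (+ n) 0} (*≡* (cong (ℤ._* + 1)
    (trans (ℤ.pos-+ m n) (sym (cong₂ ℤ._+_ (ℤ.*-identityʳ (+ m)) (ℤ.*-identityʳ (+ n))))))))
  (fromℚᵘ-+ (mkℚᵘ (+ m) 0) (mkℚᵘ (+ n) 0))

ℕ→ℚ-suc : ∀ n → ℕ→ℚ (suc n) ≡ 1ℚ + ℕ→ℚ n
ℕ→ℚ-suc = ℕ→ℚ-+ 1

ℕ→ℚ-* : ∀ m n → ℕ→ℚ (m ℕ.* n) ≡ ℕ→ℚ m * ℕ→ℚ n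
ℕ→ℚ-* m n = trans
  (fromℚᵘ-cong {mkℚᵘ (+ (m ℕ.* n)) 0} {mkℚᵘ (+ m) 0 *ᵘ mkℚᵘ (+ n) 0} (*≡* (cong (ℤ._* + 1) (ℤ.pos-* m n))))
  (fromℚᵘ-* (mkℚᵘ (+ m) 0) (mkℚᵘ (+ n) 0))

_^ℚ_ : ℚ → ℕ → ℚ
x ^ℚ zero  = 1ℚ
x ^ℚ suc k = x * x ^ℚ k

ℕ→ℚ-^ : ∀ m k → ℕ→ℚ (m ^ k) ≡ ℕ→ℚ m ^ℚ k
ℕ→ℚ-^ m zero    = refl
ℕ→ℚ-^ m (suc k) = trans (ℕ→ℚ-* m (m ^ k)) (cong (ℕ→ℚ m *_) (ℕ→ℚ-^ m k))

ℕ→ℚ-injective : ∀ {m n} → ℕ→ℚ m ≡ ℕ→ℚ n → m ≡ n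
ℕ→ℚ-injective {m} {n} eq with fromℚᵘ-injective {mkℚᵘ (+ m) 0} {mkℚᵘ (+ n) 0} eq
... | *≡* m≡n = ℤ.+-injective (trans (sym (ℤ.*-identityʳ (+ m))) (trans m≡n (ℤ.*-identityʳ (+ n))))

ℕ→ℚ-nonNeg : ∀ n → 0ℚ ≤ℚ ℕ→ℚ n
ℕ→ℚ-nonNeg n = nonNegative⁻¹ (ℕ→ℚ n) {{normalize-nonNeg n 1}}

ℕ→ℚ-pos⇒nonZero : ∀ {k} → 0ℚ < ℕ→ℚ k → ℕ.NonZero k
ℕ→ℚ-pos⇒nonZero {zero}  0<0 = contradiction 0<0 (<-irrefl refl)
ℕ→ℚ-pos⇒nonZero {suc k} _   = _

m/'n≡m*1/'n : ∀ m n .{{_ : ℕ.NonZero n}} → + m /' n ≡ ℕ→ℚ m * (+ 1 /' n)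
m/'n≡m*1/'n m (suc n) = trans
  (fromℚᵘ-cong {mkℚᵘ (+ m) n} {mkℚᵘ (+ m) 0 *ᵘ mkℚᵘ (+ 1) n}
    (*≡* (cong₂ ℤ._*_ (sym (ℤ.*-identityʳ (+ m))) (cong +_ (ℕ.*-identityˡ (suc n))))))
  (fromℚᵘ-* (mkℚᵘ (+ m) 0) (mkℚᵘ (+ 1) n))

1/'n*n≡1 : ∀ n .{{_ : ℕ.NonZero n}} → (+ 1 /' n) * ℕ→ℚ n ≡ 1ℚ
1/'n*n≡1 (suc n) = sym (trans
  (fromℚᵘ-cong {mkℚᵘ (+ 1) 0} {mkℚᵘ (+ 1) n *ᵘ mkℚᵘ (+ suc n) 0} (*≡* (trans (ℤ.*-identityˡ _)
    (trans (cong +_ (ℕ.*-identityʳ (suc n))) (sym (trans (ℤ.*-identityʳ _) (ℤ.*-identityˡ _)))))))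
  (fromℚᵘ-* (mkℚᵘ (+ 1) n) (mkℚᵘ (+ suc n) 0)))

sq-nonNeg : ∀ x → 0ℚ ≤ℚ sq x
sq-nonNeg x with ≤-total 0ℚ x
... | inj₁ 0≤x = nonNegative⁻¹ (sq x) {{nonNeg*nonNeg⇒nonNeg x {{nonNegative 0≤x}} x {{nonNegative 0≤x}}}}
... | inj₂ x≤0 = nonNegative⁻¹ (sq x) {{nonPos*nonPos⇒nonPos x {{nonPositive x≤0}} x {{nonPositive x≤0}}}}

sq-pos : ∀ x → x ≢ 0ℚ → 0ℚ < sq x
sq-pos x x≢0 with <-cmp x 0ℚ
... | tri< x<0 _ _ = positive⁻¹ (sq x) {{neg*neg⇒pos x {{negative x<0}} x {{negative x<0}}}}
... | tri≈ _ x≡0 _ = contradiction x≡0 x≢0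
... | tri> _ _ 0<x = positive⁻¹ (sq x) {{pos*pos⇒pos x {{positive 0<x}} x {{positive 0<x}}}}

*-nonNeg : ∀ {p q} → 0ℚ ≤ℚ p → 0ℚ ≤ℚ q → 0ℚ ≤ℚ p * q
*-nonNeg {p} {q} 0≤p 0≤q = nonNegative⁻¹ (p * q) {{nonNeg*nonNeg⇒nonNeg p {{nonNegative 0≤p}} q {{nonNegative 0≤q}}}}

*-pos : ∀ {p q} → 0ℚ < p → 0ℚ < q → 0ℚ < p * q
*-pos {p} {q} 0<p 0<q = positive⁻¹ (p * q) {{pos*pos⇒pos p {{positive 0<p}} q {{positive 0<q}}}}

∑ : {A : Set} → (A → ℚ) → List A → ℚ
∑ f xs = foldr _+_ 0ℚ (map f xs)

module _ {A : Set} where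

  ∑-zero : ∀ (xs : List A) → ∑ (λ _ → 0ℚ) xs ≡ 0ℚ
  ∑-zero []       = refl
  ∑-zero (x ∷ xs) = trans (+-identityˡ _) (∑-zero xs)

  ∑-const : ∀ c (xs : List A) → ∑ (λ _ → c) xs ≡ ℕ→ℚ (length xs) * c
  ∑-const c []       = sym (*-zeroˡ c)
  ∑-const c (x ∷ xs) = begin
    c + ∑ (λ _ → c) xs              ≡⟨ cong₂ _+_ (sym (*-identityˡ c)) (∑-const c xs) ⟩
    1ℚ * c + ℕ→ℚ (length xs) * c    ≡⟨ sym (*-distribʳ-+ c 1ℚ (ℕ→ℚ (length xs))) ⟩
    (1ℚ + ℕ→ℚ (length xs)) * c      ≡⟨ cong (_* c) (sym (ℕ→ℚ-suc (length xs))) ⟩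
    ℕ→ℚ (length (x ∷ xs)) * c       ∎
    where open ≡-Reasoning

  ∑-+ : ∀ (f g : A → ℚ) xs → ∑ (λ x → f x + g x) xs ≡ ∑ f xs + ∑ g xs
  ∑-+ f g []       = refl
  ∑-+ f g (x ∷ xs) = trans (cong (_+_ (f x + g x)) (∑-+ f g xs)) (interchange (f x) (g x) (∑ f xs) (∑ g xs))

  ∑-*ʳ : ∀ (f : A → ℚ) c xs → ∑ (λ x → f x * c) xs ≡ ∑ f xs * c
  ∑-*ʳ f c []       = sym (*-zeroˡ c)
  ∑-*ʳ f c (x ∷ xs) = trans (cong (_+_ (f x * c)) (∑-*ʳ f c xs)) (sym (*-distribʳ-+ c (f x) (∑ f xs)))

  ∑-cong-All : ∀ {f g : A → ℚ} {xs} → All (λ x → f x ≡ g x) xs → ∑ f xs ≡ ∑ g xs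
  ∑-cong-All []         = refl
  ∑-cong-All (eq ∷ eqs) = cong₂ _+_ eq (∑-cong-All eqs)

  ∑-cong : ∀ {f g : A → ℚ} xs → (∀ x → f x ≡ g x) → ∑ f xs ≡ ∑ g xs
  ∑-cong xs eq = ∑-cong-All (All.universal eq xs)

  ∑-mono-≤ : ∀ {f g : A → ℚ} xs → (∀ x → f x ≤ℚ g x) → ∑ f xs ≤ℚ ∑ g xs
  ∑-mono-≤ []       f≤g = ≤-refl
  ∑-mono-≤ (x ∷ xs) f≤g = +-mono-≤ (f≤g x) (∑-mono-≤ xs f≤g)

  ∑-mono-< : ∀ {f g : A → ℚ} {xs} → (∀ x → f x ≤ℚ g x) → Any (λ x → f x < g x) xs → ∑ f xs < ∑ g xs
  ∑-mono-< {xs = x ∷ xs} f≤g (here fx<gx) = +-mono-<-≤ fx<gx (∑-mono-≤ xs f≤g)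
  ∑-mono-< {xs = x ∷ xs} f≤g (there any)  = +-mono-≤-< (f≤g x) (∑-mono-< f≤g any)

  ∑-pos : ∀ {f : A → ℚ} {xs} → (∀ x → 0ℚ ≤ℚ f x) → Any (λ x → 0ℚ < f x) xs → 0ℚ < ∑ f xs
  ∑-pos {f} {xs} 0≤f any = subst (_< ∑ f xs) (∑-zero xs) (∑-mono-< 0≤f any)

  ∑-swap : ∀ (f : A → A → ℚ) xs ys →
           ∑ (λ x → ∑ (f x) ys) xs ≡ ∑ (λ y → ∑ (λ x → f x y) xs) ys
  ∑-swap f []       ys = sym (∑-zero ys)
  ∑-swap f (x ∷ xs) ys = trans (cong (_+_ (∑ (f x) ys)) (∑-swap f xs ys)) (sym (∑-+ (f x) (λ y → ∑ (λ x → f x y) xs) ys))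

  ∑-map : ∀ {B : Set} (f : B → ℚ) (g : A → B) xs → ∑ f (map g xs) ≡ ∑ (f ∘ g) xs
  ∑-map f g xs = cong (foldr _+_ 0ℚ) (sym (List.map-∘ xs))

  ℕ→ℚ-sum : ∀ (f : A → ℕ) xs → ℕ→ℚ (sum (map f xs)) ≡ ∑ (ℕ→ℚ ∘ f) xs
  ℕ→ℚ-sum f []       = refl
  ℕ→ℚ-sum f (x ∷ xs) = trans (ℕ→ℚ-+ (f x) _) (cong (_+_ (ℕ→ℚ (f x))) (ℕ→ℚ-sum f xs))

≡ᵇ-refl : ∀ n → (n ≡ᵇ n) ≡ true
≡ᵇ-refl zero    = refl
≡ᵇ-refl (suc n) = ≡ᵇ-refl n

≢⇒≡ᵇ-false : ∀ {m n} → m ≢ n → (m ≡ᵇ n) ≡ false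
≢⇒≡ᵇ-false {m} {n} m≢n with m ≡ᵇ n in eq
... | false = refl
... | true  = contradiction (ℕ.≡ᵇ⇒≡ m n (subst T (sym eq) tt)) m≢n

𝟙[_≡_] : ℕ → ℕ → ℚ
𝟙[ d ≡ k ] = ℕ→ℚ (b2n (d ≡ᵇ k))

𝟙-refl : ∀ k → 𝟙[ k ≡ k ] ≡ 1ℚ
𝟙-refl k = cong (ℕ→ℚ ∘ b2n) (≡ᵇ-refl k)

𝟙-≢ : ∀ {d k} → d ≢ k → 𝟙[ d ≡ k ] ≡ 0ℚ
𝟙-≢ d≢k = cong (ℕ→ℚ ∘ b2n) (≢⇒≡ᵇ-false d≢k)

𝟙-nonNeg : ∀ d k → 0ℚ ≤ℚ 𝟙[ d ≡ k ]
𝟙-nonNeg d k = ℕ→ℚ-nonNeg (b2n (d ≡ᵇ k))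

multiplicity : ℕ → List ℕ → ℚ
multiplicity k = ∑ 𝟙[_≡ k ]

multiplicity-nonNeg : ∀ k ds → 0ℚ ≤ℚ multiplicity k ds
multiplicity-nonNeg k ds = subst (_≤ℚ multiplicity k ds) (∑-zero ds) (∑-mono-≤ ds (λ d → 𝟙-nonNeg d k))

multiplicity-pos : ∀ {k ds} → k ∈ ds → 0ℚ < multiplicity k ds
multiplicity-pos {k} k∈ds = ∑-pos (λ d → 𝟙-nonNeg d k) (Any.map 𝟙-pos k∈ds)
  where
  𝟙-pos : ∀ {d} → k ≡ d → 0ℚ < 𝟙[ d ≡ k ]
  𝟙-pos refl = subst (0ℚ <_) (sym (𝟙-refl k)) (positive⁻¹ 1ℚ)


sqDev : ℚ → ℕ → ℚ
sqDev c d = sq (ℕ→ℚ d - c)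

two-value-identity : ∀ α β x y c →
  (β + α) * (β * sq (y - c) + α * sq (x - c)) ≡ α * β * sq (x - y) + sq (α * (x - c) + β * (y - c))
two-value-identity = solve 5 (λ α β x y c →
  (β :+ α) :* (β :* ((y :- c) :* (y :- c)) :+ α :* ((x :- c) :* (x :- c)))
    := α :* β :* ((x :- y) :* (x :- y)) :+ (α :* (x :- c) :+ β :* (y :- c)) :* (α :* (x :- c) :+ β :* (y :- c))) refl

weighted-deviation : ∀ α β x y c → α * (x - c) + β * (y - c) ≡ (β * y + α * x) - (β + α) * c
weighted-deviation = solve 5 (λ α β x y c →
  α :* (x :- c) :+ β :* (y :- c) := (β :* y :+ α :* x) :- (β :+ α) :* c) refl

constant-deviation : ∀ N x c → N * (N * (N * sq (x - c))) ≡ N * sq (N * x - N * c)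
constant-deviation = solve 3 (λ N x c →
  N :* (N :* (N :* ((x :- c) :* (x :- c)))) := N :* ((N :* x :- N :* c) :* (N :* x :- N :* c))) refl

*-sq-zero-difference : ∀ p q x → p * (q * sq (x - x)) ≡ 0ℚ
*-sq-zero-difference = solve 3 (λ p q x → p :* (q :* ((x :- x) :* (x :- x))) := con 0ℚ) refl

_∈⟨_,_⟩ : ℕ → ℕ → ℕ → Set
d ∈⟨ D , e ⟩ = d ≡ D ⊎ d ≡ e

_∈⟨_,_⟩? : ∀ d D e → Dec (d ∈⟨ D , e ⟩)
d ∈⟨ D , e ⟩? = d ℕ.≟ D ⊎-dec d ℕ.≟ e

module _ (D e : ℕ) where

  restricted : (ℕ → ℚ) → ℕ → ℚ
  restricted f d = 𝟙[ d ≡ e ] * f e + 𝟙[ d ≡ D ] * f D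

  ∑-restricted : ∀ f ds → ∑ (restricted f) ds ≡ multiplicity e ds * f e + multiplicity D ds * f D
  ∑-restricted f ds = trans (∑-+ (λ d → 𝟙[ d ≡ e ] * f e) (λ d → 𝟙[ d ≡ D ] * f D) ds)
                            (cong₂ _+_ (∑-*ʳ 𝟙[_≡ e ] (f e) ds) (∑-*ʳ 𝟙[_≡ D ] (f D) ds))

  restricted-inside : D ≢ e → ∀ f {d} → d ∈⟨ D , e ⟩ → restricted f d ≡ f d
  restricted-inside D≢e f (inj₁ refl) = begin
    𝟙[ D ≡ e ] * f e + 𝟙[ D ≡ D ] * f D ≡⟨ cong₂ (λ x y → x * f e + y * f D) (𝟙-≢ D≢e) (𝟙-refl D) ⟩
    0ℚ * f e + 1ℚ * f D                 ≡⟨ cong₂ _+_ (*-zeroˡ (f e)) (*-identityˡ (f D)) ⟩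
    0ℚ + f D                            ≡⟨ +-identityˡ (f D) ⟩
    f D                                 ∎
    where open ≡-Reasoning
  restricted-inside D≢e f (inj₂ refl) = begin
    𝟙[ e ≡ e ] * f e + 𝟙[ e ≡ D ] * f D ≡⟨ cong₂ (λ x y → x * f e + y * f D) (𝟙-refl e) (𝟙-≢ (D≢e ∘ sym)) ⟩
    1ℚ * f e + 0ℚ * f D                 ≡⟨ cong₂ _+_ (*-identityˡ (f e)) (*-zeroˡ (f D)) ⟩
    f e + 0ℚ                            ≡⟨ +-identityʳ (f e) ⟩
    f e                                 ∎
    where open ≡-Reasoning

  restricted-outside : ∀ f {d} → ¬ d ∈⟨ D , e ⟩ → restricted f d ≡ 0ℚ
  restricted-outside f {d} d∉ = begin
    𝟙[ d ≡ e ] * f e + 𝟙[ d ≡ D ] * f D ≡⟨ cong₂ (λ x y → x * f e + y * f D)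
                                                   (𝟙-≢ (d∉ ∘ inj₂)) (𝟙-≢ (d∉ ∘ inj₁)) ⟩
    0ℚ * f e + 0ℚ * f D                 ≡⟨ cong₂ _+_ (*-zeroˡ (f e)) (*-zeroˡ (f D)) ⟩
    0ℚ                                  ∎
    where open ≡-Reasoning

  restricted-≤ : D ≢ e → ∀ f d → 0ℚ ≤ℚ f d → restricted f d ≤ℚ f d
  restricted-≤ D≢e f d 0≤fd with d ∈⟨ D , e ⟩?
  ... | yes d∈ = ≤-reflexive (restricted-inside D≢e f d∈)
  ... | no  d∉ = subst (_≤ℚ f d) (sym (restricted-outside f d∉)) 0≤fd

  restricted-< : ∀ f {d} → ¬ d ∈⟨ D , e ⟩ → 0ℚ < f d → restricted f d < f d
  restricted-< f {d} d∉ = subst (_< f d) (sym (restricted-outside f d∉))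

  module _ (f : ℕ → ℚ) (ds : List ℕ) where

    multiplicity-sum≡ : D ≢ e → All (_∈⟨ D , e ⟩) ds →
                        multiplicity e ds * f e + multiplicity D ds * f D ≡ ∑ f ds
    multiplicity-sum≡ D≢e two =
      trans (sym (∑-restricted f ds)) (∑-cong-All (All.map (restricted-inside D≢e f) two))

    multiplicity-sum≤ : D ≢ e → (∀ d → 0ℚ ≤ℚ f d) →
                        multiplicity e ds * f e + multiplicity D ds * f D ≤ℚ ∑ f ds
    multiplicity-sum≤ D≢e 0≤f =
      subst (_≤ℚ ∑ f ds) (∑-restricted f ds) (∑-mono-≤ ds (λ d → restricted-≤ D≢e f d (0≤f d)))

    multiplicity-sum< : D ≢ e → (∀ d → 0ℚ < f d) → Any (¬_ ∘ _∈⟨ D , e ⟩) ds →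
                        multiplicity e ds * f e + multiplicity D ds * f D < ∑ f ds
    multiplicity-sum< D≢e 0<f outside = subst (_< ∑ f ds) (∑-restricted f ds)
      (∑-mono-< (λ d → restricted-≤ D≢e f d (<⇒≤ (0<f d))) (Any.map (λ d∉ → restricted-< f d∉ (0<f _)) outside))

  -- (Nδ + NΔ) NΔ Nδ (Δ - δ)² when D, e are the extreme degrees: n³ times the bound of the theorem.
  extremalTerm : List ℕ → ℚ
  extremalTerm ds =
    (multiplicity e ds + multiplicity D ds) * (multiplicity D ds * multiplicity e ds * sq (ℕ→ℚ D - ℕ→ℚ e))

  module _ (ds : List ℕ) where

    private
      N α β : ℚ
      N = ℕ→ℚ (length ds)
      α = multiplicity D ds
      β = multiplicity e ds

    multiplicities≡length : D ≢ e → All (_∈⟨ D , e ⟩) ds → β + α ≡ N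
    multiplicities≡length D≢e two = begin
      β + α               ≡⟨ sym (cong₂ _+_ (*-identityʳ β) (*-identityʳ α)) ⟩
      β * 1ℚ + α * 1ℚ     ≡⟨ multiplicity-sum≡ (λ _ → 1ℚ) ds D≢e two ⟩
      ∑ (λ _ → 1ℚ) ds     ≡⟨ ∑-const 1ℚ ds ⟩
      N * 1ℚ              ≡⟨ *-identityʳ N ⟩
      N                   ∎
      where open ≡-Reasoning

    multiplicities<length : D ≢ e → Any (¬_ ∘ _∈⟨ D , e ⟩) ds → β + α < N
    multiplicities<length D≢e outside = begin-strict
      β + α               ≡⟨ sym (cong₂ _+_ (*-identityʳ β) (*-identityʳ α)) ⟩
      β * 1ℚ + α * 1ℚ     <⟨ multiplicity-sum< (λ _ → 1ℚ) ds D≢e (λ _ → positive⁻¹ 1ℚ) outside ⟩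
      ∑ (λ _ → 1ℚ) ds     ≡⟨ ∑-const 1ℚ ds ⟩
      N * 1ℚ              ≡⟨ *-identityʳ N ⟩
      N                   ∎
      where open ≤-Reasoning

    extremalTerm≡ : ∀ c → All (_∈⟨ D , e ⟩) ds → N * c ≡ ∑ ℕ→ℚ ds →
                    extremalTerm ds ≡ N * (N * ∑ (sqDev c) ds)
    extremalTerm≡ c two mean with D ℕ.≟ e
    ... | yes refl = trans (*-sq-zero-difference (β + α) (α * β) (ℕ→ℚ D)) (sym (begin
      N * (N * ∑ (sqDev c) ds)      ≡⟨ cong (λ x → N * (N * x)) (∑-on-D (sqDev c)) ⟩
      N * (N * (N * sqDev c D))     ≡⟨ constant-deviation N (ℕ→ℚ D) c ⟩
      N * sq (N * ℕ→ℚ D - N * c)    ≡⟨ cong (λ x → N * sq (x - N * c)) (sym (trans mean (∑-on-D ℕ→ℚ))) ⟩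
      N * sq (N * c - N * c)        ≡⟨ cong (λ x → N * sq x) (+-inverseʳ (N * c)) ⟩
      N * 0ℚ                        ≡⟨ *-zeroʳ N ⟩
      0ℚ                            ∎))
      where
      open ≡-Reasoning
      ∑-on-D : ∀ f → ∑ f ds ≡ N * f D
      ∑-on-D f = trans (∑-cong-All (All.map (cong f ∘ [ id , id ]′) two)) (∑-const (f D) ds)
    ... | no D≢e = begin
      (β + α) * (α * β * sq (ℕ→ℚ D - ℕ→ℚ e))  ≡⟨ cong ((β + α) *_) (sym spread≡) ⟩
      (β + α) * ((β + α) * S₂)                 ≡⟨ cong₂ (λ x y → x * (x * y)) (multiplicities≡length D≢e two) S₂≡S ⟩
      N * (N * ∑ (sqDev c) ds)                 ∎
      where
      open ≡-Reasoning
      S₂ : ℚ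
      S₂ = β * sqDev c e + α * sqDev c D
      S₂≡S : S₂ ≡ ∑ (sqDev c) ds
      S₂≡S = multiplicity-sum≡ (sqDev c) ds D≢e two
      balanced : α * (ℕ→ℚ D - c) + β * (ℕ→ℚ e - c) ≡ 0ℚ
      balanced = begin
        α * (ℕ→ℚ D - c) + β * (ℕ→ℚ e - c)       ≡⟨ weighted-deviation α β (ℕ→ℚ D) (ℕ→ℚ e) c ⟩
        (β * ℕ→ℚ e + α * ℕ→ℚ D) - (β + α) * c  ≡⟨ cong₂ (λ x y → x - y * c) (multiplicity-sum≡ ℕ→ℚ ds D≢e two)
                                                          (multiplicities≡length D≢e two) ⟩
        ∑ ℕ→ℚ ds - N * c                         ≡⟨ cong (∑ ℕ→ℚ ds -_) mean ⟩
        ∑ ℕ→ℚ ds - ∑ ℕ→ℚ ds                     ≡⟨ +-inverseʳ (∑ ℕ→ℚ ds) ⟩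
        0ℚ                                       ∎
      spread≡ : (β + α) * S₂ ≡ α * β * sq (ℕ→ℚ D - ℕ→ℚ e)
      spread≡ = begin
        (β + α) * S₂
          ≡⟨ two-value-identity α β (ℕ→ℚ D) (ℕ→ℚ e) c ⟩
        α * β * sq (ℕ→ℚ D - ℕ→ℚ e) + sq (α * (ℕ→ℚ D - c) + β * (ℕ→ℚ e - c))
          ≡⟨ cong (λ x → α * β * sq (ℕ→ℚ D - ℕ→ℚ e) + sq x) balanced ⟩
        α * β * sq (ℕ→ℚ D - ℕ→ℚ e) + sq 0ℚ
          ≡⟨ +-identityʳ _ ⟩
        α * β * sq (ℕ→ℚ D - ℕ→ℚ e)
          ∎

    extremalTerm< : ∀ c → D ≢ e → D ∈ ds → e ∈ ds → Any (¬_ ∘ _∈⟨ D , e ⟩) ds →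
                    extremalTerm ds < N * (N * ∑ (sqDev c) ds)
    extremalTerm< c D≢e D∈ds e∈ds outside = begin-strict
      (β + α) * P               <⟨ *-monoˡ-<-pos P {{positive 0<P}} A<N ⟩
      N * P                     ≤⟨ N*-mono P≤AS₂ ⟩
      N * ((β + α) * S₂)        ≤⟨ N*-mono (*-monoʳ-≤-nonNeg S₂ {{nonNegative 0≤S₂}} (<⇒≤ A<N)) ⟩
      N * (N * S₂)              ≤⟨ N*-mono (N*-mono S₂≤S) ⟩
      N * (N * ∑ (sqDev c) ds)  ∎
      where
      open ≤-Reasoning
      P S₂ : ℚ
      P = α * β * sq (ℕ→ℚ D - ℕ→ℚ e)
      S₂ = β * sqDev c e + α * sqDev c D
      A<N : β + α < N
      A<N = multiplicities<length D≢e outside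
      N*-mono : ∀ {p q} → p ≤ℚ q → N * p ≤ℚ N * q
      N*-mono = *-monoˡ-≤-nonNeg N {{nonNegative (ℕ→ℚ-nonNeg (length ds))}}
      0≤S₂ : 0ℚ ≤ℚ S₂
      0≤S₂ = +-mono-≤ (*-nonNeg (multiplicity-nonNeg e ds) (sq-nonNeg (ℕ→ℚ e - c)))
                      (*-nonNeg (multiplicity-nonNeg D ds) (sq-nonNeg (ℕ→ℚ D - c)))
      S₂≤S : S₂ ≤ℚ ∑ (sqDev c) ds
      S₂≤S = multiplicity-sum≤ (sqDev c) ds D≢e (λ d → sq-nonNeg (ℕ→ℚ d - c))
      0<P : 0ℚ < P
      0<P = *-pos (*-pos (multiplicity-pos D∈ds) (multiplicity-pos e∈ds))
                  (sq-pos (ℕ→ℚ D - ℕ→ℚ e) (D≢e ∘ ℕ→ℚ-injective ∘ x∙y⁻¹≈ε⇒x≈y (ℕ→ℚ D) (ℕ→ℚ e)))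
      P≤AS₂ : P ≤ℚ (β + α) * S₂
      P≤AS₂ = begin
        P                                             ≡⟨ sym (+-identityʳ P) ⟩
        P + 0ℚ                                        ≤⟨ +-monoʳ-≤ P (sq-nonNeg (α * (ℕ→ℚ D - c) + β * (ℕ→ℚ e - c))) ⟩
        P + sq (α * (ℕ→ℚ D - c) + β * (ℕ→ℚ e - c))     ≡⟨ sym (two-value-identity α β (ℕ→ℚ D) (ℕ→ℚ e) c) ⟩
        (β + α) * S₂                                  ∎

maxL-upper : ∀ ds → All (_≤ maxL ds) ds
maxL-upper []       = []
maxL-upper (d ∷ ds) = ℕ.m≤m⊔n d (maxL ds) ∷ All.map (λ d′≤ → ℕ.≤-trans d′≤ (ℕ.m≤n⊔m d (maxL ds))) (maxL-upper ds)

maxL-∈ : ∀ d ds → maxL (d ∷ ds) ∈ d ∷ ds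
maxL-∈ d ds with foldr-selective ℕ.⊔-sel 0 (d ∷ ds)
... | inj₂ max∈ = max∈
... | inj₁ max≡0 = here (trans max≡0 (sym (ℕ.n≤0⇒n≡0 (subst (d ≤_) max≡0 (ℕ.m≤m⊔n d (maxL ds))))))

foldr-⊓-lower : ∀ d ds → All (foldr ℕ._⊓_ d ds ≤_) (d ∷ ds)
foldr-⊓-lower d []       = ℕ.≤-refl ∷ []
foldr-⊓-lower d (d′ ∷ ds) with foldr-⊓-lower d ds
... | m≤d ∷ m≤ds =
  ℕ.≤-trans (ℕ.m⊓n≤n d′ _) m≤d ∷ ℕ.m⊓n≤m d′ _ ∷ All.map (ℕ.≤-trans (ℕ.m⊓n≤n d′ _)) m≤ds

minL-lower : ∀ ds → All (minL ds ≤_) ds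
minL-lower []       = []
minL-lower (d ∷ ds) = foldr-⊓-lower d ds

minL-∈ : ∀ d ds → minL (d ∷ ds) ∈ d ∷ ds
minL-∈ d ds with foldr-selective ℕ.⊓-sel d ds
... | inj₁ min≡d = here min≡d
... | inj₂ min∈  = there min∈

maxL≡minL⇒constant : ∀ ds → maxL ds ≡ minL ds → All (_≡ maxL ds) ds
maxL≡minL⇒constant ds max≡min = All.zipWith
  (λ (d≤max , min≤d) → ℕ.≤-antisym d≤max (subst (_≤ _) (sym max≡min) min≤d))
  (maxL-upper ds , minL-lower ds)

pigeonhole : ∀ {D e x y z} → x ∈⟨ D , e ⟩ → y ∈⟨ D , e ⟩ → z ∈⟨ D , e ⟩ → x ≡ y ⊎ (y ≡ z ⊎ x ≡ z)
pigeonhole (inj₁ refl) (inj₁ refl) _           = inj₁ refl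
pigeonhole (inj₂ refl) (inj₂ refl) _           = inj₁ refl
pigeonhole (inj₁ refl) (inj₂ refl) (inj₁ refl) = inj₂ (inj₂ refl)
pigeonhole (inj₁ refl) (inj₂ refl) (inj₂ refl) = inj₂ (inj₁ refl)
pigeonhole (inj₂ refl) (inj₁ refl) (inj₁ refl) = inj₂ (inj₁ refl)
pigeonhole (inj₂ refl) (inj₁ refl) (inj₂ refl) = inj₂ (inj₂ refl)

b2n-<ᵇ-split : ∀ {m n} → m ≢ n → b2n (m <ᵇ n) +ℕ b2n (n <ᵇ m) ≡ 1
b2n-<ᵇ-split {zero}  {zero}  m≢n = contradiction refl m≢n
b2n-<ᵇ-split {zero}  {suc n} m≢n = refl
b2n-<ᵇ-split {suc m} {zero}  m≢n = refl
b2n-<ᵇ-split {suc m} {suc n} m≢n = b2n-<ᵇ-split (m≢n ∘ cong suc)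

module _ {n : ℕ} (G : SimpleGraph n) where

  private
    e< e> : Fin n → Fin n → ℕ
    e< i j = b2n (adj G i j ∧ (toℕ i <ᵇ toℕ j))
    e> i j = b2n (adj G i j ∧ (toℕ j <ᵇ toℕ i))
    E< E> : Fin n → Fin n → ℚ
    E< i j = ℕ→ℚ (e< i j)
    E> i j = ℕ→ℚ (e> i j)

  adj-split : ∀ i j → b2n (adj G i j) ≡ e< i j +ℕ e> i j
  adj-split i j with i Fin.≟ j
  ... | yes refl rewrite irrefl G i = refl
  ... | no i≢j with adj G i j
  ...   | true  = sym (b2n-<ᵇ-split (i≢j ∘ Fin.toℕ-injective))
  ...   | false = refl

  handshake : ℕ→ℚ (2 ℕ.* edges G) ≡ ∑ (ℕ→ℚ ∘ deg G) (allFin n)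
  handshake = begin
    ℕ→ℚ (2 ℕ.* edges G)                                         ≡⟨ cong ℕ→ℚ (cong (edges G +ℕ_) (ℕ.+-identityʳ (edges G))) ⟩
    ℕ→ℚ (edges G +ℕ edges G)                                    ≡⟨ ℕ→ℚ-+ (edges G) (edges G) ⟩
    ℕ→ℚ (edges G) + ℕ→ℚ (edges G)                               ≡⟨ cong₂ _+_ edges-< edges-> ⟩
    ∑ (λ i → ∑ (E< i) xs) xs + ∑ (λ i → ∑ (E> i) xs) xs          ≡⟨ sym (∑-+ _ _ xs) ⟩
    ∑ (λ i → ∑ (E< i) xs + ∑ (E> i) xs) xs                      ≡⟨ ∑-cong xs (λ i → sym (∑-+ (E< i) (E> i) xs)) ⟩
    ∑ (λ i → ∑ (λ j → E< i j + E> i j) xs) xs                   ≡⟨ ∑-cong xs (λ i → sym (deg-split i)) ⟩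
    ∑ (ℕ→ℚ ∘ deg G) xs                                          ∎
    where
    open ≡-Reasoning
    xs : List (Fin n)
    xs = allFin n
    edges-< : ℕ→ℚ (edges G) ≡ ∑ (λ i → ∑ (E< i) xs) xs
    edges-< = trans (ℕ→ℚ-sum _ xs) (∑-cong xs (λ i → ℕ→ℚ-sum _ xs))
    edges-> : ℕ→ℚ (edges G) ≡ ∑ (λ i → ∑ (E> i) xs) xs
    edges-> = trans edges-< (trans (∑-swap E< xs xs)
      (∑-cong xs (λ j → ∑-cong xs (λ i → cong (λ b → ℕ→ℚ (b2n (b ∧ (toℕ i <ᵇ toℕ j)))) (SimpleGraph.sym G i j)))))
    deg-split : ∀ i → ℕ→ℚ (deg G i) ≡ ∑ (λ j → E< i j + E> i j) xs
    deg-split i = trans (ℕ→ℚ-sum _ xs) (∑-cong xs (λ j → trans (cong ℕ→ℚ (adj-split i j)) (ℕ→ℚ-+ (e< i j) (e> i j))))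

  ℕ→ℚ-Ndeg : ∀ k → ℕ→ℚ (Ndeg G k) ≡ multiplicity k (degrees G)
  ℕ→ℚ-Ndeg k = trans (ℕ→ℚ-sum (λ i → b2n (deg G i ≡ᵇ k)) (allFin n)) (sym (∑-map 𝟙[_≡ k ] (deg G) (allFin n)))

  length-degrees : length (degrees G) ≡ n
  length-degrees = trans (List.length-map (deg G) (allFin n)) (List.length-tabulate id)

  two-valued⇒AtMostTwoDegrees : All (_∈⟨ Δ G , δ G ⟩) (degrees G) → AtMostTwoDegrees G
  two-valued⇒AtMostTwoDegrees two i j k = pigeonhole (deg∈ i) (deg∈ j) (deg∈ k)
    where
    deg∈ : ∀ i → deg G i ∈⟨ Δ G , δ G ⟩
    deg∈ i = All.lookup two (∈-map⁺ (deg G) (∈-allFin i))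

-- v, w and h stand for the inverses of n⁴, Nδ + NΔ and 2 introduced by the divisions in the bound.
bound-normal-form : ∀ {A B N δ two u v w h} →
  u * N ≡ 1ℚ → v * N ^ℚ 4 ≡ 1ℚ → w * (B + A) ≡ 1ℚ → h * two ≡ 1ℚ →
  ((B + A) ^ℚ 2 * v) * ((N * h) * δ) * (((two * A) * B * w) * δ)
    ≡ (B + A) * (A * B * sq δ) * (u * (u * u))
bound-normal-form {A} {B} {N} {δ} {two} {u} {v} {w} {h} uN≡1 vN⁴≡1 wA≡1 htwo≡1 = begin
  L                                                 ≡⟨ sym (*-identityʳ L) ⟩
  L * 1ℚ                                            ≡⟨ cong (L *_) (sym (cong (λ x → x * (x * x)) uN≡1)) ⟩
  L * ((u * N) * ((u * N) * (u * N)))               ≡⟨ regroup A B N δ two u v w h ⟩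
  (v * (N * (N * (N * (N * 1ℚ))))) * (w * (B + A)) * (h * two) * R
                                                    ≡⟨ cong₂ (λ x y → x * y * (h * two) * R) vN⁴≡1 wA≡1 ⟩
  1ℚ * 1ℚ * (h * two) * R                          ≡⟨ cong (λ x → 1ℚ * 1ℚ * x * R) htwo≡1 ⟩
  1ℚ * 1ℚ * 1ℚ * R                                 ≡⟨ *-identityˡ R ⟩
  R                                                 ∎
  where
  open ≡-Reasoning
  L R : ℚ
  L = ((B + A) ^ℚ 2 * v) * ((N * h) * δ) * (((two * A) * B * w) * δ)
  R = (B + A) * (A * B * sq δ) * (u * (u * u))
  regroup : ∀ A B N δ two u v w h →
    ((B + A) * ((B + A) * 1ℚ) * v) * ((N * h) * δ) * (((two * A) * B * w) * δ) * ((u * N) * ((u * N) * (u * N)))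
      ≡ (v * (N * (N * (N * (N * 1ℚ))))) * (w * (B + A)) * (h * two) * ((B + A) * (A * B * sq δ) * (u * (u * u)))
  regroup = solve 9 (λ A B N δ two u v w h →
    ((B :+ A) :* ((B :+ A) :* con 1ℚ) :* v) :* ((N :* h) :* δ) :* (((two :* A) :* B :* w) :* δ) :* ((u :* N) :* ((u :* N) :* (u :* N)))
      := (v :* (N :* (N :* (N :* (N :* con 1ℚ))))) :* (w :* (B :+ A)) :* (h :* two) :* ((B :+ A) :* (A :* B :* (δ :* δ)) :* (u :* (u :* u)))) refl

varianceLowerBound : {n : ℕ} → SimpleGraph n → ℚ
varianceLowerBound {n} G = (+ ((Nδ G +ℕ NΔ G) ^ 2) /' (n ^ 4)) * IRR G * IRD G

module _ {n : ℕ} (G : SimpleGraph (suc n)) where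

  private
    ds : List ℕ
    ds = degrees G
    N u c : ℚ
    N = ℕ→ℚ (length ds)
    u = + 1 /' suc n
    c = + (2 ℕ.* edges G) /' suc n

  -- degrees G computes to a non-empty list because the vertex set is Fin (suc n).
  Δ∈ds : Δ G ∈ ds
  Δ∈ds = maxL-∈ _ _

  δ∈ds : δ G ∈ ds
  δ∈ds = minL-∈ _ _

  uN≡1 : u * N ≡ 1ℚ
  uN≡1 = trans (cong (u *_) (cong ℕ→ℚ (length-degrees G))) (1/'n*n≡1 (suc n))

  mean-degree : N * c ≡ ∑ ℕ→ℚ ds
  mean-degree = begin
    N * c                              ≡⟨ cong (N *_) (m/'n≡m*1/'n (2 ℕ.* edges G) (suc n)) ⟩
    N * (ℕ→ℚ (2 ℕ.* edges G) * u)      ≡⟨ solve 3 (λ N m u → N :* (m :* u) := m :* (u :* N)) refl N (ℕ→ℚ (2 ℕ.* edges G)) u ⟩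
    ℕ→ℚ (2 ℕ.* edges G) * (u * N)      ≡⟨ cong (ℕ→ℚ (2 ℕ.* edges G) *_) uN≡1 ⟩
    ℕ→ℚ (2 ℕ.* edges G) * 1ℚ           ≡⟨ *-identityʳ _ ⟩
    ℕ→ℚ (2 ℕ.* edges G)                ≡⟨ handshake G ⟩
    ∑ (ℕ→ℚ ∘ deg G) (allFin (suc n))   ≡⟨ sym (∑-map ℕ→ℚ (deg G) (allFin (suc n))) ⟩
    ∑ ℕ→ℚ ds                           ∎
    where open ≡-Reasoning

  Var≡u*S : Var G ≡ u * ∑ (sqDev c) ds
  Var≡u*S = cong (u *_) (sym (∑-map (sqDev c) (deg G) (allFin (suc n))))

  varianceLowerBound-normal-form : varianceLowerBound G ≡ extremalTerm (Δ G) (δ G) ds * (u * (u * u))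
  varianceLowerBound-normal-form = begin
    (+ ((b +ℕ a) ^ 2) /' (suc n ^ 4)) * ((+ suc n /' 2) * δq) * ((+ (2 ℕ.* a ℕ.* b) /' (b +ℕ a)) * δq)
      ≡⟨ cong₂ (λ x z → x * ((+ suc n /' 2) * δq) * (z * δq))
               (m/'n≡m*1/'n ((b +ℕ a) ^ 2) (suc n ^ 4)) (m/'n≡m*1/'n (2 ℕ.* a ℕ.* b) (b +ℕ a)) ⟩
    (ℕ→ℚ ((b +ℕ a) ^ 2) * v) * ((+ suc n /' 2) * δq) * ((ℕ→ℚ (2 ℕ.* a ℕ.* b) * w) * δq)
      ≡⟨ cong (λ y → (ℕ→ℚ ((b +ℕ a) ^ 2) * v) * (y * δq) * ((ℕ→ℚ (2 ℕ.* a ℕ.* b) * w) * δq))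
              (m/'n≡m*1/'n (suc n) 2) ⟩
    (ℕ→ℚ ((b +ℕ a) ^ 2) * v) * ((N₀ * h) * δq) * ((ℕ→ℚ (2 ℕ.* a ℕ.* b) * w) * δq)
      ≡⟨ cong₂ (λ x y → (x * v) * ((N₀ * h) * δq) * ((y * w) * δq)) B+A-sq 2AB ⟩
    ((B + A) ^ℚ 2 * v) * ((N₀ * h) * δq) * (((ℕ→ℚ 2 * A) * B * w) * δq)
      ≡⟨ bound-normal-form {A} {B} {N₀} {δq} {ℕ→ℚ 2} {u} {v} {w} {h}
           (1/'n*n≡1 (suc n)) (trans (cong (v *_) (sym (ℕ→ℚ-^ (suc n) 4))) (1/'n*n≡1 (suc n ^ 4)))
           (trans (cong (w *_) (sym B+A)) (1/'n*n≡1 (b +ℕ a))) (1/'n*n≡1 2) ⟩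
    extremalTerm (Δ G) (δ G) ds * (u * (u * u))
      ∎
    where
    open ≡-Reasoning
    a b : ℕ
    a = NΔ G
    b = Nδ G
    A B N₀ δq v w h : ℚ
    A = multiplicity (Δ G) ds
    B = multiplicity (δ G) ds
    N₀ = ℕ→ℚ (suc n)
    δq = ℕ→ℚ (Δ G) - ℕ→ℚ (δ G)
    B+A : ℕ→ℚ (b +ℕ a) ≡ B + A
    B+A = trans (ℕ→ℚ-+ b a) (cong₂ _+_ (ℕ→ℚ-Ndeg G (δ G)) (ℕ→ℚ-Ndeg G (Δ G)))
    B+A-sq : ℕ→ℚ ((b +ℕ a) ^ 2) ≡ (B + A) ^ℚ 2
    B+A-sq = trans (ℕ→ℚ-^ (b +ℕ a) 2) (cong (_^ℚ 2) B+A)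
    2AB : ℕ→ℚ (2 ℕ.* a ℕ.* b) ≡ ℕ→ℚ 2 * A * B
    2AB = trans (ℕ→ℚ-* (2 ℕ.* a) b)
                (cong₂ _*_ (trans (ℕ→ℚ-* 2 a) (cong (ℕ→ℚ 2 *_) (ℕ→ℚ-Ndeg G (Δ G)))) (ℕ→ℚ-Ndeg G (δ G)))
    instance
      b+a≢0 : ℕ.NonZero (b +ℕ a)
      b+a≢0 = ℕ→ℚ-pos⇒nonZero (subst (0ℚ <_) (sym B+A)
        (+-mono-<-≤ (multiplicity-pos δ∈ds) (multiplicity-nonNeg (Δ G) ds)))
    v = + 1 /' (suc n ^ 4)
    w = + 1 /' (b +ℕ a)
    h = + 1 /' 2

  regular⇒two-valued : Δ G ≡ δ G → All (_∈⟨ Δ G , δ G ⟩) ds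
  regular⇒two-valued Δ≡δ = All.map inj₁ (maxL≡minL⇒constant ds Δ≡δ)

  AtMostTwoDegrees⇒two-valued : AtMostTwoDegrees G → All (_∈⟨ Δ G , δ G ⟩) ds
  AtMostTwoDegrees⇒two-valued amt with ∈-map⁻ (deg G) Δ∈ds | ∈-map⁻ (deg G) δ∈ds
  ... | i , _ , Δ≡degi | j , _ , δ≡degj = map⁺ (All.universal classify (allFin (suc n)))
    where
    classify : ∀ k → deg G k ∈⟨ Δ G , δ G ⟩
    classify k with amt i j k
    ... | inj₁ degi≡degj        = All.lookup (regular⇒two-valued (trans Δ≡degi (trans degi≡degj (sym δ≡degj))))
                                             (∈-map⁺ (deg G) (∈-allFin k))
    ... | inj₂ (inj₁ degj≡degk) = inj₂ (sym (trans δ≡degj degj≡degk))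
    ... | inj₂ (inj₂ degi≡degk) = inj₁ (sym (trans Δ≡degi degi≡degk))

  u³-cancels-N² : ∀ S → N * (N * S) * (u * (u * u)) ≡ u * S
  u³-cancels-N² S = begin
    N * (N * S) * (u * (u * u))     ≡⟨ solve 3 (λ N S u → N :* (N :* S) :* (u :* (u :* u))
                                                  := (u :* N) :* ((u :* N) :* (u :* S))) refl N S u ⟩
    (u * N) * ((u * N) * (u * S))   ≡⟨ cong (λ x → x * (x * (u * S))) uN≡1 ⟩
    1ℚ * (1ℚ * (u * S))             ≡⟨ trans (*-identityˡ (1ℚ * (u * S))) (*-identityˡ (u * S)) ⟩
    u * S                           ∎
    where open ≡-Reasoning

  varianceLowerBound≡Var : All (_∈⟨ Δ G , δ G ⟩) ds → varianceLowerBound G ≡ Var G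
  varianceLowerBound≡Var two = begin
    varianceLowerBound G                          ≡⟨ varianceLowerBound-normal-form ⟩
    extremalTerm (Δ G) (δ G) ds * (u * (u * u))   ≡⟨ cong (_* (u * (u * u))) (extremalTerm≡ (Δ G) (δ G) ds c two mean-degree) ⟩
    N * (N * ∑ (sqDev c) ds) * (u * (u * u))      ≡⟨ u³-cancels-N² (∑ (sqDev c) ds) ⟩
    u * ∑ (sqDev c) ds                            ≡⟨ sym Var≡u*S ⟩
    Var G                                         ∎
    where open ≡-Reasoning

  varianceLowerBound<Var : ¬ All (_∈⟨ Δ G , δ G ⟩) ds → varianceLowerBound G < Var G
  varianceLowerBound<Var ¬two = begin-strict
    varianceLowerBound G                          ≡⟨ varianceLowerBound-normal-form ⟩
    extremalTerm (Δ G) (δ G) ds * (u * (u * u))   <⟨ *-monoˡ-<-pos (u * (u * u)) {{positive 0<u³}}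
                                                       (extremalTerm< (Δ G) (δ G) ds c Δ≢δ Δ∈ds δ∈ds outside) ⟩
    N * (N * ∑ (sqDev c) ds) * (u * (u * u))      ≡⟨ u³-cancels-N² (∑ (sqDev c) ds) ⟩
    u * ∑ (sqDev c) ds                            ≡⟨ sym Var≡u*S ⟩
    Var G                                         ∎
    where
    open ≤-Reasoning
    Δ≢δ : Δ G ≢ δ G
    Δ≢δ = ¬two ∘ regular⇒two-valued
    outside : Any (¬_ ∘ _∈⟨ Δ G , δ G ⟩) ds
    outside = ¬All⇒Any¬ (_∈⟨ Δ G , δ G ⟩?) ds ¬two
    0<u : 0ℚ < u
    0<u = positive⁻¹ u {{normalize-pos 1 (suc n)}}
    0<u³ : 0ℚ < u * (u * u)
    0<u³ = *-pos 0<u (*-pos 0<u 0<u)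

theorem5 : (n : ℕ) → 1 ≤ n → (G : SimpleGraph n) →
    ((+ ((Nδ G +ℕ NΔ G) ^ 2) /' (n ^ 4)) * IRR G * IRD G ≤ℚ Var G)
    × (((+ ((Nδ G +ℕ NΔ G) ^ 2) /' (n ^ 4)) * IRR G * IRD G ≡ Var G) ⇔ AtMostTwoDegrees G)
theorem5 zero    ()
theorem5 (suc n) _ G = by-cases (All.all? (_∈⟨ Δ G , δ G ⟩?) (degrees G))
  where
  by-cases : Dec (All (_∈⟨ Δ G , δ G ⟩) (degrees G)) →
             (varianceLowerBound G ≤ℚ Var G) × (varianceLowerBound G ≡ Var G ⇔ AtMostTwoDegrees G)
  by-cases (yes two) = ≤-reflexive (varianceLowerBound≡Var G two) ,
                       mk⇔ (λ _ → two-valued⇒AtMostTwoDegrees G two) (λ _ → varianceLowerBound≡Var G two)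
  by-cases (no ¬two) = <⇒≤ (varianceLowerBound<Var G ¬two) ,
                       mk⇔ (λ eq → contradiction eq (<⇒≢ (varianceLowerBound<Var G ¬two)))
                           (λ amt → contradiction (AtMostTwoDegrees⇒two-valued G amt) ¬two)
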